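{- For any integers $m,n\geq 3$, the grid graph $G_{n,m}$ has a minimum connected dominating set that contains none of the four corners $(1,1),(n,1),(1,m),(n,m)$.
   Context: The grid graph $G_{n,m}$ has vertex set $\{1,\dots,n\}\times\{1,\dots,m\}$, with $(i_1,j_1)$ and $(i_2,j_2)$ adjacent iff $|i_1-i_2|+|j_1-j_2|=1$. A connected dominating set of a graph $G=(V,E)$ is a set $S \subseteq V$ such that $G[S]$ is connected and every vertex of $V$ is in $S$ or adjacent to a vertex of $S$; a minimum one is one of smallest cardinality. -}

module Defs where

open import Data.Nat using (ℕ; zero; suc; _+_; _≤_; _∸_)
open import Data.Fin using (Fin; toℕ)
open import Data.Bool using (Bool; true; false; if_then_else_)
open import Data.Product using (_×_; _,_; Σ; ∃)
open import Data.Sum using (_⊎_)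
open import Data.List using (List; map; allFin; cartesianProduct)
open import Data.Nat.ListAction using (sum)
open import Relation.Binary.PropositionalEquality using (_≡_)

-- Vertices of the grid graph G_{n,m}: pairs (i , j) with i : Fin n, j : Fin m.
-- (0-indexed: Fin value k stands for coordinate k+1 of the paper.)
Vertex : ℕ → ℕ → Set
Vertex n m = Fin n × Fin m

AdjFin : ∀ {k} → Fin k → Fin k → Set
AdjFin a b = (suc (toℕ a) ≡ toℕ b) ⊎ (suc (toℕ b) ≡ toℕ a)

Adj : ∀ {n m} → Vertex n m → Vertex n m → Set
Adj (i₁ , j₁) (i₂ , j₂) =
  (i₁ ≡ i₂ × AdjFin j₁ j₂) ⊎ (AdjFin i₁ i₂ × j₁ ≡ j₂)

VSet : ℕ → ℕ → Set
VSet n m = Vertex n m → Bool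

_∈S_ : ∀ {n m} → Vertex n m → VSet n m → Set
v ∈S S = S v ≡ true

card : ∀ {n m} → VSet n m → ℕ
card {n} {m} S =
  sum (map (λ v → if S v then 1 else 0) (cartesianProduct (allFin n) (allFin m)))

data WalkIn {n m} (S : VSet n m) : Vertex n m → Vertex n m → Set where
  here : ∀ {u} → u ∈S S → WalkIn S u u
  step : ∀ {u w v} → u ∈S S → Adj u w → WalkIn S w v → WalkIn S u v

Connected : ∀ {n m} → VSet n m → Set
Connected S = ∀ u v → u ∈S S → v ∈S S → WalkIn S u v

Dominating : ∀ {n m} → VSet n m → Set
Dominating {n} {m} S =
  ∀ (v : Vertex n m) → v ∈S S ⊎ Σ (Vertex n m) (λ u → u ∈S S × Adj u v)

ConnectedDominating : ∀ {n m} → VSet n m → Set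
ConnectedDominating S = Connected S × Dominating S

MinimumCDS : ∀ {n m} → VSet n m → Set
MinimumCDS {n} {m} S =
  ConnectedDominating S × (∀ (T : VSet n m) → ConnectedDominating T → card S ≤ card T)

IsEnd : ∀ {k} → Fin k → Set
IsEnd {k} a = (toℕ a ≡ 0) ⊎ (toℕ a ≡ k ∸ 1)

IsCorner : ∀ {n m} → Vertex n m → Set
IsCorner (i , j) = IsEnd i × IsEnd j

-- A minimum connected dominating set S exists because there are finitely many vertex sets
-- and being a connected dominating set is decidable. If S contains a corner c, let d be
-- the vertex diagonally inward from c. Every neighbour of c is adjacent to d, so in
-- S − c + d each walk through c can be rerouted through d, every vertex dominated by c
-- is dominated by d, and c itself stays dominated by the neighbour through which S
-- leaves c. Hence S − c + d is again a connected dominating set of at most the same size,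
-- and since d is not a corner, the four corners can be cleared one after the other.
module Submission where

open import Defs
open import Data.Nat using (ℕ; zero; suc; _+_; _*_; _≤_; _<_; z≤n; s≤s; _≟_; _<?_)
open import Data.Nat.Properties
  using (+-mono-≤; +-mono-<-≤; +-mono-≤-<; +-assoc; +-comm; +-identityʳ; m≤m+n; ≤-refl;
         ≤-trans; ≤-<-trans; ≤-pred; <⇒≢; 1+n≢n; <⇒≱; ≮⇒≥; suc-injective; module ≤-Reasoning)
open import Data.Fin using (Fin; toℕ; fromℕ; inject₁; combine; remQuot)
  renaming (zero to fzero; suc to fsuc)
import Data.Fin.Properties as Fin
open import Data.Fin.Subset.Properties using (anySubset?)
open import Data.Bool using (Bool; true; false; if_then_else_)
import Data.Bool.Properties as Bool
open import Data.Vec using (Vec; lookup; tabulate)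
open import Data.Vec.Properties using (lookup∘tabulate)
open import Data.Product using (Σ; ∃; _×_; _,_; proj₁; proj₂)
open import Data.Product.Properties using (≡-dec)
open import Data.Sum using (_⊎_; inj₁; inj₂; [_,_])
import Data.Sum as Sum
open import Data.List using (List; []; _∷_; map; length; allFin; cartesianProduct)
open import Data.List.Properties using (map-cong; map-cong-local)
open import Data.Nat.ListAction using (sum)
open import Data.List.Membership.Propositional using (_∈_)
open import Data.List.Membership.Propositional.Properties using (∈-allFin; ∈-cartesianProduct⁺; ∈-cartesianProduct⁻)
open import Data.List.Relation.Unary.Any using (here; there)
import Data.List.Relation.Unary.All as All
open import Data.List.Relation.Unary.AllPairs using (_∷_)
open import Data.List.Relation.Unary.Unique.Propositional using (Unique)
import Data.List.Relation.Unary.Unique.Propositional.Properties as Unique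
open import Data.Empty using (⊥-elim)
open import Function using (id; _∘_; case_of_)
open import Relation.Binary.PropositionalEquality
  using (_≡_; _≢_; refl; sym; trans; cong; cong₂; subst; _≗_; module ≡-Reasoning)
open import Relation.Nullary using (Dec; yes; no; does; ¬_; contradiction)
open import Relation.Nullary.Decidable using (map′; _×-dec_; _⊎-dec_; _→-dec_; dec-true)

module _ {A : Set} where

  sum-map-mono : ∀ {f g : A → ℕ} → (∀ x → f x ≤ g x) → ∀ xs → sum (map f xs) ≤ sum (map g xs)
  sum-map-mono f≤g [] = z≤n
  sum-map-mono f≤g (x ∷ xs) = +-mono-≤ (f≤g x) (sum-map-mono f≤g xs)

  sum-map-mono-< : ∀ {f g : A → ℕ} {y xs} → (∀ x → f x ≤ g x) → y ∈ xs → f y < g y →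
                   sum (map f xs) < sum (map g xs)
  sum-map-mono-< {xs = _ ∷ xs} f≤g (here refl) fy<gy = +-mono-<-≤ fy<gy (sum-map-mono f≤g xs)
  sum-map-mono-< {xs = x ∷ _} f≤g (there y∈xs) fy<gy =
    +-mono-≤-< (f≤g x) (sum-map-mono-< f≤g y∈xs fy<gy)

  sum-map-≤-length : ∀ {f : A → ℕ} → (∀ x → f x ≤ 1) → ∀ xs → sum (map f xs) ≤ length xs
  sum-map-≤-length f≤1 [] = z≤n
  sum-map-≤-length f≤1 (x ∷ xs) = +-mono-≤ (f≤1 x) (sum-map-≤-length f≤1 xs)

  sum-map-exchange : ∀ {f g : A → ℕ} {y xs} → Unique xs → y ∈ xs → (∀ x → x ≢ y → f x ≡ g x) →
                     sum (map f xs) + g y ≡ sum (map g xs) + f y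
  sum-map-exchange {f} {g} {xs = y ∷ xs} (y∉xs ∷ _) (here refl) f≡g = begin
    (f y + sum (map f xs)) + g y ≡⟨ cong (λ s → (f y + s) + g y) same-rest ⟩
    (f y + sum (map g xs)) + g y ≡⟨ +-comm (f y + sum (map g xs)) (g y) ⟩
    g y + (f y + sum (map g xs)) ≡⟨ cong (g y +_) (+-comm (f y) (sum (map g xs))) ⟩
    g y + (sum (map g xs) + f y) ≡⟨ +-assoc (g y) (sum (map g xs)) (f y) ⟨
    (g y + sum (map g xs)) + f y ∎
    where
      open ≡-Reasoning
      same-rest : sum (map f xs) ≡ sum (map g xs)
      same-rest = cong sum (map-cong-local (All.map (λ y≢x → f≡g _ (y≢x ∘ sym)) y∉xs))
  sum-map-exchange {f} {g} {y} {x ∷ xs} (x∉xs ∷ unique) (there y∈xs) f≡g = begin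
    (f x + sum (map f xs)) + g y ≡⟨ +-assoc (f x) _ (g y) ⟩
    f x + (sum (map f xs) + g y) ≡⟨ cong₂ _+_ (f≡g x (All.lookup x∉xs y∈xs))
                                             (sum-map-exchange {xs = xs} unique y∈xs f≡g) ⟩
    g x + (sum (map g xs) + f y) ≡⟨ +-assoc (g x) _ (f y) ⟨
    (g x + sum (map g xs)) + f y ∎
    where open ≡-Reasoning

bit : Bool → ℕ
bit b = if b then 1 else 0

bit≤1 : ∀ b → bit b ≤ 1
bit≤1 true = s≤s z≤n
bit≤1 false = z≤n

bit-mono : ∀ {a b} → (a ≡ true → b ≡ true) → bit a ≤ bit b
bit-mono {false} _ = z≤n
bit-mono {true} a⇒b rewrite a⇒b refl = s≤s z≤n

does-true : ∀ {P : Set} (p? : Dec P) → does p? ≡ true → P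
does-true (yes p) _ = p

AdjFin-sym : ∀ {k} {a b : Fin k} → AdjFin a b → AdjFin b a
AdjFin-sym = Sum.swap

AdjFin-irrefl : ∀ {k} {a : Fin k} → ¬ AdjFin a a
AdjFin-irrefl (inj₁ 1+a≡a) = 1+n≢n 1+a≡a
AdjFin-irrefl (inj₂ 1+a≡a) = 1+n≢n 1+a≡a

AdjFin-suc : ∀ {k} {a b : Fin k} → AdjFin a b → AdjFin (fsuc a) (fsuc b)
AdjFin-suc = Sum.map (cong suc) (cong suc)

AdjFin? : ∀ {k} (a b : Fin k) → Dec (AdjFin a b)
AdjFin? a b = (suc (toℕ a) ≟ toℕ b) ⊎-dec (suc (toℕ b) ≟ toℕ a)

Adj-sym : ∀ {n m} {u v : Vertex n m} → Adj u v → Adj v u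
Adj-sym = Sum.map (λ (i≡ , j~) → sym i≡ , AdjFin-sym j~) (λ (i~ , j≡) → AdjFin-sym i~ , sym j≡)

Adj-irrefl : ∀ {n m} {u : Vertex n m} → ¬ Adj u u
Adj-irrefl = [ AdjFin-irrefl ∘ proj₂ , AdjFin-irrefl ∘ proj₁ ]

Adj⇒≢ : ∀ {n m} {u v : Vertex n m} → Adj u v → u ≢ v
Adj⇒≢ u~v refl = Adj-irrefl u~v

Adj? : ∀ {n m} (u v : Vertex n m) → Dec (Adj u v)
Adj? (i , j) (i′ , j′) = ((i Fin.≟ i′) ×-dec AdjFin? j j′) ⊎-dec (AdjFin? i i′ ×-dec (j Fin.≟ j′))

module _ {n m : ℕ} where

  _≟V_ : (u v : Vertex n m) → Dec (u ≡ v)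
  _≟V_ = ≡-dec Fin._≟_ Fin._≟_

  vertices : List (Vertex n m)
  vertices = cartesianProduct (allFin n) (allFin m)

  ∈-vertices : ∀ v → v ∈ vertices
  ∈-vertices (i , j) = ∈-cartesianProduct⁺ (∈-allFin i) (∈-allFin j)

  vertices-unique : Unique vertices
  vertices-unique = Unique.cartesianProduct⁺ (Unique.allFin⁺ n) (Unique.allFin⁺ m)

  ∀-vertex? : {P : Vertex n m → Set} → (∀ v → Dec (P v)) → Dec (∀ v → P v)
  ∀-vertex? P? = map′ (λ h (i , j) → h i j) (λ h i j → h (i , j))
                      (Fin.all? λ i → Fin.all? λ j → P? (i , j))

  ∃-vertex? : {P : Vertex n m → Set} → (∀ v → Dec (P v)) → Dec (∃ P)
  ∃-vertex? P? = map′ (λ (i , j , p) → (i , j) , p) (λ ((i , j) , p) → i , j , p)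
                      (Fin.any? λ i → Fin.any? λ j → P? (i , j))

  _∈?_ : ∀ v (S : VSet n m) → Dec (v ∈S S)
  v ∈? S = S v Bool.≟ true

  _⊆_ : VSet n m → VSet n m → Set
  S ⊆ T = ∀ {v} → v ∈S S → v ∈S T

  ⊆-∉ : ∀ {S T : VSet n m} {v} → (v ∈S T → v ∈S S) → S v ≡ false → T v ≡ false
  ⊆-∉ T⊆S v∉S = Bool.¬-not λ v∈T → contradiction (trans (sym v∉S) (T⊆S v∈T)) λ ()

  ≗⇒⊆ : ∀ {S T : VSet n m} → S ≗ T → S ⊆ T
  ≗⇒⊆ S≗T {v} = trans (sym (S≗T v))

  card-cong : ∀ {S T : VSet n m} → S ≗ T → card S ≡ card T
  card-cong S≗T = cong sum (map-cong (cong bit ∘ S≗T) vertices)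

  card-≤-length : ∀ (S : VSet n m) → card S ≤ length vertices
  card-≤-length S = sum-map-≤-length (bit≤1 ∘ S) vertices

  card-⊂ : ∀ {S T : VSet n m} {w} → S ⊆ T → w ∈S T → S w ≡ false → card S < card T
  card-⊂ {S} {T} {w} S⊆T w∈T w∉S = sum-map-mono-< (λ v → bit-mono S⊆T) (∈-vertices w) bit-Sw<bit-Tw
    where
      bit-Sw<bit-Tw : bit (S w) < bit (T w)
      bit-Sw<bit-Tw rewrite w∈T | w∉S = s≤s z≤n

  _[_≔_] : VSet n m → Vertex n m → Bool → VSet n m
  (S [ v ≔ b ]) w = if does (w ≟V v) then b else S w

  update-≡ : ∀ {S : VSet n m} {v b} → (S [ v ≔ b ]) v ≡ b
  update-≡ {v = v} with v ≟V v
  ... | yes _ = refl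
  ... | no v≢v = contradiction refl v≢v

  update-≢ : ∀ {S : VSet n m} {v w b} → w ≢ v → (S [ v ≔ b ]) w ≡ S w
  update-≢ {v = v} {w} w≢v with w ≟V v
  ... | yes w≡v = contradiction w≡v w≢v
  ... | no _ = refl

  card-update : ∀ {S : VSet n m} {v b} → card (S [ v ≔ b ]) + bit (S v) ≡ card S + bit b
  card-update {S} {v} {b} =
    trans (sum-map-exchange vertices-unique (∈-vertices v) (λ w w≢v → cong bit (update-≢ {S = S} w≢v)))
          (cong (λ c → card S + bit c) (update-≡ {S = S}))

module _ {n m : ℕ} {S : VSet n m} where

  walk-head : ∀ {u v} → WalkIn S u v → u ∈S S
  walk-head (here u∈S) = u∈S
  walk-head (step u∈S _ _) = u∈S

  walk-last : ∀ {u v} → WalkIn S u v → v ∈S S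
  walk-last (here v∈S) = v∈S
  walk-last (step _ _ walk) = walk-last walk

  _++ʷ_ : ∀ {u v w} → WalkIn S u v → WalkIn S v w → WalkIn S u w
  here _ ++ʷ walk′ = walk′
  step u∈S u~x walk ++ʷ walk′ = step u∈S u~x (walk ++ʷ walk′)

  reverseʷ : ∀ {u v} → WalkIn S u v → WalkIn S v u
  reverseʷ (here u∈S) = here u∈S
  reverseʷ (step u∈S u~x walk) = reverseʷ walk ++ʷ step (walk-head walk) (Adj-sym u~x) (here u∈S)

  first-step : ∀ {u v} → WalkIn S u v → u ≢ v → ∃ λ w → Adj u w × w ∈S S
  first-step (here _) u≢u = contradiction refl u≢u
  first-step (step _ u~w walk) _ = _ , u~w , walk-head walk

module _ {n m : ℕ} {S T : VSet n m} where

  walk-mono : S ⊆ T → ∀ {u v} → WalkIn S u v → WalkIn T u v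
  walk-mono S⊆T (here u∈S) = here (S⊆T u∈S)
  walk-mono S⊆T (step u∈S u~w walk) = step (S⊆T u∈S) u~w (walk-mono S⊆T walk)

  CDS-resp-≗ : S ≗ T → ConnectedDominating S → ConnectedDominating T
  CDS-resp-≗ S≗T (connected , dominating) = connectedT , dominatingT
    where
      T⊆S : T ⊆ S
      T⊆S = ≗⇒⊆ (sym ∘ S≗T)
      connectedT : Connected T
      connectedT u v u∈T v∈T = walk-mono (≗⇒⊆ S≗T) (connected u v (T⊆S u∈T) (T⊆S v∈T))
      dominatingT : Dominating T
      dominatingT v = Sum.map (≗⇒⊆ S≗T) (λ (u , u∈S , u~v) → u , ≗⇒⊆ S≗T u∈S , u~v) (dominating v)

module _ {n m : ℕ} where

  decidedSet : {P : Vertex n m → Set} → (∀ v → Dec (P v)) → VSet n m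
  decidedSet P? v = does (P? v)

  ascending-chain-stabilises : (R : ℕ → VSet n m) → (∀ k → R k ⊆ R (suc k)) →
                               ∃ λ j → R (suc j) ⊆ R j
  ascending-chain-stabilises R R-mono =
    [ id , (λ N≤card → contradiction (card-≤-length (R N)) (<⇒≱ N≤card)) ] (grows N)
    where
      N : ℕ
      N = suc (length (vertices {n} {m}))
      grows : ∀ k → (∃ λ j → R (suc j) ⊆ R j) ⊎ k ≤ card (R k)
      grows zero = inj₂ z≤n
      grows (suc k) with grows k
      ... | inj₁ stable = inj₁ stable
      ... | inj₂ k≤card with ∃-vertex? (λ w → (w ∈? R (suc k)) ×-dec (R k w Bool.≟ false))
      ... | yes (w , new , ¬old) = inj₂ (≤-<-trans k≤card (card-⊂ {S = R k} (R-mono k) new ¬old))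
      ... | no none = inj₁ (k , λ {w} new → Bool.¬-not (λ ¬old → none (w , new , ¬old)))

module Reachability {n m : ℕ} (S : VSet n m) (u : Vertex n m) where

  reach : ℕ → VSet n m
  reach-grows? : ∀ k w → Dec (w ∈S reach k ⊎ (w ∈S S × ∃ λ x → x ∈S reach k × Adj x w))

  reach zero = decidedSet (_≟V u)
  reach (suc k) = decidedSet (reach-grows? k)

  reach-grows? k w =
    (w ∈? reach k) ⊎-dec ((w ∈? S) ×-dec ∃-vertex? λ x → (x ∈? reach k) ×-dec Adj? x w)

  reach-mono : ∀ k → reach k ⊆ reach (suc k)
  reach-mono k {w} w∈ = dec-true (reach-grows? k w) (inj₁ w∈)

  reach-step : ∀ {k x w} → x ∈S reach k → Adj x w → w ∈S S → w ∈S reach (suc k)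
  reach-step {k} {x} {w} x∈ x~w w∈S = dec-true (reach-grows? k w) (inj₂ (w∈S , x , x∈ , x~w))

  u∈reach : ∀ k → u ∈S reach k
  u∈reach zero = dec-true (u ≟V u) refl
  u∈reach (suc k) = reach-mono k (u∈reach k)

  reach-sound : u ∈S S → ∀ k {w} → w ∈S reach k → WalkIn S u w
  reach-sound u∈S zero {w} w∈ with does-true (w ≟V u) w∈
  ... | refl = here u∈S
  reach-sound u∈S (suc k) {w} w∈ with does-true (reach-grows? k w) w∈
  ... | inj₁ w∈′ = reach-sound u∈S k w∈′
  ... | inj₂ (w∈S , x , x∈ , x~w) = let walk = reach-sound u∈S k x∈ in
    walk ++ʷ step (walk-last walk) x~w (here w∈S)

  reach-complete : ∀ {j} → reach (suc j) ⊆ reach j → ∀ {x w} → x ∈S reach j → WalkIn S x w →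
                   w ∈S reach j
  reach-complete closed x∈ (here _) = x∈
  reach-complete {j} closed x∈ (step _ x~y walk) =
    reach-complete {j} closed (closed (reach-step {j} x∈ x~y (walk-head walk))) walk

  walk? : ∀ w → Dec (WalkIn S u w)
  walk? w with u ∈? S
  ... | no u∉S = no (u∉S ∘ walk-head)
  ... | yes u∈S with ascending-chain-stabilises reach reach-mono
  ... | j , closed = map′ (reach-sound u∈S j) (reach-complete {j} closed (u∈reach j)) (w ∈? reach j)

ConnectedDominating? : ∀ {n m} (S : VSet n m) → Dec (ConnectedDominating S)
ConnectedDominating? S = connected? ×-dec dominating?
  where
    connected? = ∀-vertex? λ u → ∀-vertex? λ v → (u ∈? S) →-dec ((v ∈? S) →-dec Reachability.walk? S u v)
    dominating? = ∀-vertex? λ v → (v ∈? S) ⊎-dec ∃-vertex? λ u → (u ∈? S) ×-dec Adj? u v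

module _ {n m : ℕ} where

  fromVec : Vec Bool (n * m) → VSet n m
  fromVec p (i , j) = lookup p (combine i j)

  toVec : VSet n m → Vec Bool (n * m)
  toVec S = tabulate (S ∘ remQuot m)

  fromVec-toVec : ∀ S → fromVec (toVec S) ≗ S
  fromVec-toVec S (i , j) = trans (lookup∘tabulate _ (combine i j)) (cong S (Fin.remQuot-combine i j))

  ∃-VSet? : {Q : VSet n m → Set} → (∀ {S T} → S ≗ T → Q S → Q T) → (∀ S → Dec (Q S)) →
            Dec (∃ Q)
  ∃-VSet? Q-resp Q? = map′ (λ (p , q) → fromVec p , q)
                           (λ (S , q) → toVec S , Q-resp (sym ∘ fromVec-toVec S) q)
                           (anySubset? (Q? ∘ fromVec))

  minimum-below : ∀ k (S : VSet n m) → card S ≤ k → ConnectedDominating S →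
                  ∃ (MinimumCDS {n} {m})
  minimum-below zero S card≤0 S-cds = S , S-cds , λ _ _ → ≤-trans card≤0 z≤n
  minimum-below (suc k) S card≤ S-cds with ∃-VSet? smaller-resp smaller?
    where
      Smaller : VSet n m → Set
      Smaller T = ConnectedDominating T × card T < card S
      smaller? : ∀ T → Dec (Smaller T)
      smaller? T = ConnectedDominating? T ×-dec (card T <? card S)
      smaller-resp : ∀ {T T′} → T ≗ T′ → Smaller T → Smaller T′
      smaller-resp T≗T′ (T-cds , T<S) = CDS-resp-≗ T≗T′ T-cds , subst (_< card S) (card-cong T≗T′) T<S
  ... | yes (T , T-cds , T<S) = minimum-below k T (≤-pred (≤-trans T<S card≤)) T-cds
  ... | no none = S , S-cds , λ T T-cds → ≮⇒≥ (λ T<S → none (T , T-cds , T<S))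

data LinePath {k} : Fin k → Fin k → Set where
  stop : ∀ {a} → LinePath a a
  move : ∀ {a b c} → AdjFin a b → LinePath b c → LinePath a c

LinePath-suc : ∀ {k} {a b : Fin k} → LinePath a b → LinePath (fsuc a) (fsuc b)
LinePath-suc stop = stop
LinePath-suc (move a~b path) = move (AdjFin-suc a~b) (LinePath-suc path)

LinePath-from-zero : ∀ {k} (a : Fin (suc k)) → LinePath fzero a
LinePath-from-zero fzero = stop
LinePath-from-zero {suc k} (fsuc a) = move (inj₁ refl) (LinePath-suc (LinePath-from-zero a))

module _ {n m : ℕ} where

  full : VSet n m
  full _ = true

  column-walk : ∀ {i i′} j → LinePath i i′ → WalkIn full (i , j) (i′ , j)
  column-walk j stop = here refl
  column-walk j (move i~ path) = step refl (inj₂ (i~ , refl)) (column-walk j path)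

  row-walk : ∀ i {j j′} → LinePath j j′ → WalkIn full (i , j) (i , j′)
  row-walk i stop = here refl
  row-walk i (move j~ path) = step refl (inj₁ (refl , j~)) (row-walk i path)

full-connected : ∀ {n m} → Connected (full {suc n} {suc m})
full-connected (i , j) (i′ , j′) _ _ =
  reverseʷ (column-walk j (LinePath-from-zero i)) ++ʷ
  (reverseʷ (row-walk fzero (LinePath-from-zero j)) ++ʷ
  (row-walk fzero (LinePath-from-zero j′) ++ʷ column-walk j′ (LinePath-from-zero i′)))

-- Opaque because the minimum is found by exhaustive search over all vertex sets,
-- which the type checker must never start evaluating.
opaque
  minimum-exists : ∀ {n m} → ∃ (MinimumCDS {suc n} {suc m})
  minimum-exists {n} {m} = minimum-below {suc n} {suc m} _ full ≤-refl (full-connected , λ _ → inj₁ refl)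

module Exchange {n m : ℕ} {S : VSet n m} {c d : Vertex n m} (S-min : MinimumCDS S) (c∈S : c ∈S S)
                (d≢c : d ≢ c) (N[c]⊆N[d] : ∀ {w} → Adj c w → Adj w d) where

  S-connected : Connected S
  S-connected = proj₁ (proj₁ S-min)

  S-dominating : Dominating S
  S-dominating = proj₂ (proj₁ S-min)

  S′ : VSet n m
  S′ = (S [ c ≔ false ]) [ d ≔ true ]

  c∉S′ : S′ c ≡ false
  c∉S′ = trans (update-≢ {S = S [ c ≔ false ]} (d≢c ∘ sym)) (update-≡ {S = S})

  d∈S′ : d ∈S S′
  d∈S′ = update-≡ {S = S [ c ≔ false ]} {v = d}

  ∈S′⁺ : ∀ {v} → v ∈S S → v ≢ c → v ∈S S′
  ∈S′⁺ {v} v∈S v≢c = case v ≟V d of λ where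
    (yes refl) → d∈S′
    (no v≢d) → trans (update-≢ {S = S [ c ≔ false ]} v≢d) (trans (update-≢ {S = S} v≢c) v∈S)

  ∈S′⁻ : ∀ {v} → v ∈S S′ → v ≢ d → v ∈S S × v ≢ c
  ∈S′⁻ {v} v∈S′ v≢d = case v ≟V c of λ where
    (yes refl) → contradiction (trans (sym c∉S′) v∈S′) λ ()
    (no v≢c) → trans (sym (trans (update-≢ {S = S [ c ≔ false ]} v≢d) (update-≢ {S = S} v≢c))) v∈S′ ,
               v≢c

  -- S contains a vertex other than c: d itself, or a vertex dominating d (which is not c, as c ≁ d).
  exit : ∃ λ e → Adj c e × e ∈S S
  exit with S-dominating d
  ... | inj₁ d∈S = first-step (S-connected c d c∈S d∈S) (d≢c ∘ sym)
  ... | inj₂ (x , x∈S , x~d) = first-step (S-connected c x c∈S x∈S) c≢x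
    where c≢x : c ≢ x
          c≢x refl = Adj-irrefl (N[c]⊆N[d] x~d)

  e : Vertex n m
  e = proj₁ exit

  c~e : Adj c e
  c~e = proj₁ (proj₂ exit)

  e∈S′ : e ∈S S′
  e∈S′ = ∈S′⁺ (proj₂ (proj₂ exit)) (Adj⇒≢ c~e ∘ sym)

  reroute : ∀ {x y} → WalkIn S x y → x ≢ c → y ≢ c → WalkIn S′ x y
  detour : ∀ {y} → WalkIn S c y → y ≢ c → WalkIn S′ d y

  reroute (here x∈S) x≢c _ = here (∈S′⁺ x∈S x≢c)
  reroute (step {w = w} x∈S x~w walk) x≢c y≢c with w ≟V c
  ... | no w≢c = step (∈S′⁺ x∈S x≢c) x~w (reroute walk w≢c y≢c)
  ... | yes refl = step (∈S′⁺ x∈S x≢c) (N[c]⊆N[d] (Adj-sym x~w)) (detour walk y≢c)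

  detour (here _) y≢c = contradiction refl y≢c
  detour (step _ c~z walk) y≢c =
    step d∈S′ (Adj-sym (N[c]⊆N[d] c~z)) (reroute walk (Adj⇒≢ c~z ∘ sym) y≢c)

  anchor : ∀ {x} → x ∈S S′ → ∃ λ x′ → x′ ∈S S × x′ ≢ c × WalkIn S′ x′ x
  anchor {x} x∈S′ = case x ≟V d of λ where
    (yes refl) → e , proj₂ (proj₂ exit) , Adj⇒≢ c~e ∘ sym , step e∈S′ (N[c]⊆N[d] c~e) (here d∈S′)
    (no x≢d) → x , proj₁ (∈S′⁻ x∈S′ x≢d) , proj₂ (∈S′⁻ x∈S′ x≢d) , here x∈S′

  S′-connected : Connected S′
  S′-connected x y x∈S′ y∈S′ with anchor x∈S′ | anchor y∈S′
  ... | x′ , x′∈S , x′≢c , x′→x | y′ , y′∈S , y′≢c , y′→y =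
    reverseʷ x′→x ++ʷ (reroute (S-connected x′ y′ x′∈S y′∈S) x′≢c y′≢c ++ʷ y′→y)

  S′-dominating : Dominating S′
  S′-dominating v = case v ≟V c of λ where
    (yes refl) → inj₂ (e , e∈S′ , Adj-sym c~e)
    (no v≢c) → case S-dominating v of λ where
      (inj₁ v∈S) → inj₁ (∈S′⁺ v∈S v≢c)
      (inj₂ (x , x∈S , x~v)) → case x ≟V c of λ where
        (yes refl) → inj₂ (d , d∈S′ , Adj-sym (N[c]⊆N[d] x~v))
        (no x≢c) → inj₂ (x , ∈S′⁺ x∈S x≢c , x~v)

  card-S′≤card-S : card S′ ≤ card S
  card-S′≤card-S = begin
    card S′                                      ≤⟨ m≤m+n (card S′) _ ⟩
    card S′ + bit ((S [ c ≔ false ]) d)          ≡⟨ card-update {S = S [ c ≔ false ]} ⟩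
    card (S [ c ≔ false ]) + 1                   ≡⟨ cong (λ b → card (S [ c ≔ false ]) + bit b) c∈S ⟨
    card (S [ c ≔ false ]) + bit (S c)           ≡⟨ card-update {S = S} ⟩
    card S + 0                                   ≡⟨ +-identityʳ (card S) ⟩
    card S                                       ∎
    where open ≤-Reasoning

  S′-minimum : MinimumCDS S′
  S′-minimum = (S′-connected , S′-dominating) , λ T T-cds → ≤-trans card-S′≤card-S (proj₂ S-min T T-cds)

exchange : ∀ {n m} {S : VSet n m} {c d} → MinimumCDS S → d ≢ c → (∀ {w} → Adj c w → Adj w d) →
           ∃ λ T → MinimumCDS T × T c ≡ false × (∀ {v} → v ≢ d → v ∈S T → v ∈S S)
exchange {S = S} {c} S-min d≢c N[c]⊆N[d] with S c in c∈?S
... | false = S , S-min , c∈?S , λ _ → id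
... | true = S′ , S′-minimum , c∉S′ , λ v≢d v∈S′ → proj₁ (∈S′⁻ v∈S′ v≢d)
  where open Exchange S-min c∈?S d≢c N[c]⊆N[d]

ends : ∀ {k} → List (Fin (3 + k))
ends {k} = fzero ∷ fromℕ (2 + k) ∷ []

IsEnd⇒∈ends : ∀ {k} {e : Fin (3 + k)} → IsEnd e → e ∈ ends
IsEnd⇒∈ends {e = fzero} _ = here refl
IsEnd⇒∈ends {e = fsuc _} (inj₁ ())
IsEnd⇒∈ends {k} {fsuc _} (inj₂ e≡2+k) =
  there (here (Fin.toℕ-injective (trans e≡2+k (sym (Fin.toℕ-fromℕ (2 + k))))))

record EndNeighbour {k} (e : Fin (3 + k)) : Set where
  field
    inner : Fin (3 + k)
    adjacent : AdjFin e inner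
    unique : ∀ {x} → AdjFin e x → x ≡ inner
    inner∉ends : ¬ inner ∈ ends

end-neighbour : ∀ {k} {e : Fin (3 + k)} → e ∈ ends → EndNeighbour e
end-neighbour (here refl) = record
  { inner = fsuc fzero
  ; adjacent = inj₁ refl
  ; unique = λ { (inj₁ 1≡x) → Fin.toℕ-injective (sym 1≡x) ; (inj₂ ()) }
  ; inner∉ends = λ { (here ()) ; (there (here ())) }
  }
end-neighbour {k} (there (here refl)) = record
  { inner = inject₁ (fromℕ (1 + k))
  ; adjacent = inj₂ (cong suc (Fin.toℕ-inject₁ (fromℕ (1 + k))))
  ; unique = λ where
      (inj₁ 3+k≡x) → ⊥-elim (<⇒≢ (Fin.toℕ<n _) (trans (sym 3+k≡x) (cong suc (Fin.toℕ-fromℕ (2 + k)))))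
      (inj₂ x+1≡2+k) → Fin.toℕ-injective (trans (suc-injective x+1≡2+k) (sym (Fin.toℕ-inject₁ _)))
  ; inner∉ends = λ { (here ()) ; (there (here inner≡last)) → Fin.fromℕ≢inject₁ (sym inner≡last) }
  }

module _ {t s : ℕ} where

  corners : List (Vertex (3 + t) (3 + s))
  corners = cartesianProduct ends ends

  clear-corner : ∀ {S : VSet (3 + t) (3 + s)} {c} → MinimumCDS S → c ∈ corners →
                 ∃ λ T → MinimumCDS T × T c ≡ false × (∀ {v} → v ∈ corners → v ∈S T → v ∈S S)
  clear-corner {c = i , j} S-min c∈corners =
    let T , T-min , c∉T , T⊆S+d = exchange S-min d≢c N[c]⊆N[d]
    in T , T-min , c∉T , T⊆S+d ∘ corner≢d
    where
      open EndNeighbour (end-neighbour (proj₁ (∈-cartesianProduct⁻ ends ends c∈corners)))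
        renaming (inner to i′; adjacent to i~i′; unique to i′-unique; inner∉ends to i′∉ends)
      open EndNeighbour (end-neighbour (proj₂ (∈-cartesianProduct⁻ ends ends c∈corners)))
        renaming (inner to j′; adjacent to j~j′; unique to j′-unique; inner∉ends to j′∉ends)
      d : Vertex (3 + t) (3 + s)
      d = i′ , j′
      d≢c : d ≢ (i , j)
      d≢c d≡c = AdjFin-irrefl (subst (AdjFin i) (cong proj₁ d≡c) i~i′)
      N[c]⊆N[d] : ∀ {w} → Adj (i , j) w → Adj w d
      N[c]⊆N[d] (inj₁ (refl , j~y)) = inj₂ (i~i′ , j′-unique j~y)
      N[c]⊆N[d] (inj₂ (i~x , refl)) = inj₁ (i′-unique i~x , j~j′)
      corner≢d : ∀ {v} → v ∈ corners → v ≢ d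
      corner≢d v∈corners refl = i′∉ends (proj₁ (∈-cartesianProduct⁻ ends ends v∈corners))

  clear-corners : ∀ (cs : List (Vertex (3 + t) (3 + s))) → (∀ {v} → v ∈ cs → v ∈ corners) →
                  ∃ λ S → MinimumCDS S × (∀ {v} → v ∈ cs → S v ≡ false)
  clear-corners [] _ = proj₁ minimum-exists , proj₂ minimum-exists , λ ()
  clear-corners (c ∷ cs) cs⊆corners
    with S , S-min , cs∉S ← clear-corners cs (cs⊆corners ∘ there)
    with T , T-min , c∉T , T⊆S ← clear-corner S-min (cs⊆corners (here refl)) =
      T , T-min , λ where
        (here refl) → c∉T
        (there v∈cs) → ⊆-∉ {S = S} {T} (T⊆S (cs⊆corners (there v∈cs))) (cs∉S v∈cs)

lemma2 : (n m : ℕ) → 3 ≤ n → 3 ≤ m →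
    Σ (VSet n m) (λ S → MinimumCDS S × (∀ (v : Vertex n m) → IsCorner v → S v ≡ false))
lemma2 _ _ (s≤s (s≤s (s≤s {n = t} _))) (s≤s (s≤s (s≤s {n = s} _))) =
  let S , S-min , corners∉S = clear-corners {t} {s} corners id in
    S , S-min , λ (i , j) (i-end , j-end) →
      corners∉S (∈-cartesianProduct⁺ (IsEnd⇒∈ends i-end) (IsEnd⇒∈ends j-end))
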